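{- For all integers $b\geqslant 2$, we have $\ell(b)\leqslant (b-1)\beta(b)$.
   Context: For an integer $b\geqslant 2$ and a set $S\subseteq \{0,1,\dots,b-1\}$, the Kempner set $\mathcal{K}(S,b)$ is the set of non-negative integers whose base-$b$ expansions use only digits from $S$. It is called proper if $0\in S$ and $S\neq\{0,1,\dots,b-1\}$. $\ell(b)$ denotes the length (number of terms) of the longest arithmetic progression (with nonzero common difference) contained in some proper Kempner set of base $b$. For a positive integer $n$, $\rho(n)$ is the product of the distinct primes dividing $n$, and $\beta(b)$ is the largest positive integer $m<b$ with $\rho(m)\mid b$. -}

module Defs where

open import Data.Nat using (ℕ; zero; suc; _+_; _*_; _∸_; _<_; _≤_)
open import Data.Nat.Divisibility using (_∣_; _∣?_)
open import Data.Nat.Primality using (Prime; prime?)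
open import Data.List using (List; filter; upTo)
open import Data.Nat.ListAction using (product)
open import Data.Fin using (Fin; toℕ)
open import Data.Fin.Subset using (Subset; _∈_; _∉_)
open import Data.Product using (Σ; ∃; _×_)
open import Relation.Nullary using (yes; no)
open import Relation.Nullary.Decidable using (_×-dec_)
open import Relation.Binary.PropositionalEquality using (_≡_)

rad : ℕ → ℕ
rad n = product (filter (λ p → prime? p ×-dec (p ∣? n)) (upTo (suc n)))

-- β(b): largest positive m < b with ρ(m) ∣ b.
-- betaFrom b k = largest m ∈ {1,…,k} with ρ(m) ∣ b (0 if none).
betaFrom : ℕ → ℕ → ℕ
betaFrom b zero = zero
betaFrom b (suc k) with rad (suc k) ∣? b
... | yes _ = suc k
... | no  _ = betaFrom b k

beta : ℕ → ℕ
beta b = betaFrom b (b ∸ 1)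

-- Membership in the Kempner set K(S,b): n has a base-b expansion using only
-- digits from S.  n = d + b * m with d the last digit and m the remaining digits;
-- the empty expansion represents 0 (0 ∈ S for proper Kempner sets anyway).
data InKempner (b : ℕ) (S : Subset b) : ℕ → Set where
  kempner-zero : InKempner b S 0
  kempner-digit : ∀ (d : Fin b) (m : ℕ) → d ∈ S → InKempner b S m →
                  InKempner b S (toℕ d + b * m)

Proper : (b : ℕ) → Subset b → Set
Proper b S = (Σ (Fin b) λ d → toℕ d ≡ 0 × d ∈ S) × (Σ (Fin b) λ d → d ∉ S)

APIn : (b : ℕ) → Subset b → ℕ → ℕ → ℕ → Set
APIn b S a d k = ∀ i → i < k → InKempner b S (a + i * d)

{-# OPTIONS --safe #-}
-- Since 0 ∈ S ≠ {0,…,b-1}, some digit x ≠ 0 is missing from S. Choose s with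
-- G = gcd(d, b^(s+1)) ≤ b^s < gcd(d, b^s)·b. Modulo M = b^(s+1) the progression a + i d
-- stays in one residue class mod G and visits it with period Q = M / G, so among any
-- Q - c + 1 consecutive terms, c = ⌊b^s / G⌋, one lies in the window [x b^s, (x+1) b^s)
-- of numbers whose digit at position s is x; that term is not in K(S,b). Finally
-- Q - c ≤ (b-1) q for q = b^s / gcd(d, b^s), a divisor of b^s below b, hence q ≤ β(b).
module Submission where

open import Defs
open import Data.Nat using (ℕ; _*_; _∸_; _<_; _≤_)
open import Data.Fin.Subset using (Subset)

open import Data.Nat
  using ( zero; suc; _+_; _^_; _≤?_; z≤n; s≤s
        ; NonZero; >-nonZero; >-nonZero⁻¹; ≢-nonZero; ≢-nonZero⁻¹; nonTrivial⇒≢1)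
open import Data.Nat.Properties
open import Data.Nat.Divisibility
open import Data.Nat.DivMod
open import Data.Nat.GCD
  using ( gcd; GCD; module GCD; GCD-/; gcd-GCD
        ; gcd[m,n]∣m; gcd[m,n]∣n; gcd-greatest; gcd[m,n]≢0; gcd[m,n]≤n; gcd-zeroʳ)
open import Data.Nat.Coprimality using (Coprime; coprime-divisor; GCD≡1⇒coprime)
  renaming (sym to coprime-sym)
open import Data.Nat.Primality
  using (Prime; prime?; euclidsLemma; prime⇒irreducible; prime⇒nonTrivial; productOfPrimes≢0)
open import Data.Nat.ListAction using (product)
open import Data.List using (upTo)
open import Data.List.Relation.Unary.All using (All; []; _∷_) renaming (map to All-map)
open import Data.List.Relation.Unary.All.Properties using (all-filter)
open import Data.List.Relation.Unary.AllPairs using ([]; _∷_)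
open import Data.List.Relation.Unary.Unique.Propositional using (Unique)
open import Data.List.Relation.Unary.Unique.Propositional.Properties using (upTo⁺; filter⁺)
open import Data.Fin as Fin using (Fin; toℕ; fromℕ<)
open import Data.Fin.Properties using (toℕ-injective; toℕ<n; toℕ-fromℕ<; pigeonhole)
open import Data.Fin.Subset using (_∈_; _∉_)
open import Data.Product using (∃-syntax; _×_; _,_; proj₁)
open import Data.Sum using (inj₁; inj₂)
open import Relation.Nullary using (¬_; Dec; yes; no; contradiction)
open import Relation.Nullary.Decidable using (_×-dec_)
open import Relation.Binary.PropositionalEquality
open import Data.Nat.Solver using (module +-*-Solver)
open +-*-Solver using (solve; _:+_; _:*_; _:=_; con)

prime∤1 : ∀ {p} → Prime p → ¬ p ∣ 1
prime∤1 pp p∣1 = nonTrivial⇒≢1 {{prime⇒nonTrivial pp}} (∣1⇒≡1 p∣1)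

prime∣^⇒∣ : ∀ {p} m n → Prime p → p ∣ m ^ n → p ∣ m
prime∣^⇒∣ m zero    pp p∣1 = contradiction p∣1 (prime∤1 pp)
prime∣^⇒∣ m (suc n) pp p∣ with euclidsLemma m (m ^ n) pp p∣
... | inj₁ p∣m   = p∣m
... | inj₂ p∣m^n = prime∣^⇒∣ m n pp p∣m^n

prime∤product : ∀ {p qs} → Prime p → All Prime qs → All (p ≢_) qs → ¬ p ∣ product qs
prime∤product pp []         []           = prime∤1 pp
prime∤product pp (pq ∷ pqs) (p≢q ∷ p≢qs) p∣ with euclidsLemma _ _ pp p∣
... | inj₂ p∣rest = prime∤product pp pqs p≢qs p∣rest
... | inj₁ p∣q with prime⇒irreducible pq p∣q
...   | inj₁ p≡1 = prime∤1 pp (subst (_∣ 1) (sym p≡1) ∣-refl)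
...   | inj₂ p≡q = p≢q p≡q

prime∤⇒coprime : ∀ {p n} → Prime p → ¬ p ∣ n → Coprime p n
prime∤⇒coprime pp p∤n (e∣p , e∣n) with prime⇒irreducible pp e∣p
... | inj₁ e≡1    = e≡1
... | inj₂ refl   = contradiction e∣n p∤n

coprime-∣⇒*∣ : ∀ {m n k} .{{_ : NonZero n}} → Coprime m n → m ∣ k → n ∣ k → m * n ∣ k
coprime-∣⇒*∣ {m} m⊥n m∣k n∣k =
  m∣n/o⇒m*o∣n n∣k (coprime-divisor m⊥n (subst (m ∣_) (sym (m*[n/m]≡n n∣k)) m∣k))

distinctPrimes∣⇒product∣ : ∀ {ps n} → Unique ps → All (λ p → Prime p × p ∣ n) ps → product ps ∣ n
distinctPrimes∣⇒product∣ []          []                = 1∣ _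
distinctPrimes∣⇒product∣ (p∉ps ∷ u) ((pp , p∣n) ∷ ps∣n) =
  coprime-∣⇒*∣ {{productOfPrimes≢0 ps-prime}}
    (prime∤⇒coprime pp (prime∤product pp ps-prime p∉ps)) p∣n (distinctPrimes∣⇒product∣ u ps∣n)
  where
    ps-prime = All-map proj₁ ps∣n

∣^⇒rad∣ : ∀ m n s → m ∣ n ^ s → rad m ∣ n
∣^⇒rad∣ m n s m∣n^s = distinctPrimes∣⇒product∣ (filter⁺ P? (upTo⁺ (suc m)))
  (All-map (λ (pp , p∣m) → pp , prime∣^⇒∣ n s pp (∣-trans p∣m m∣n^s)) (all-filter P? (upTo (suc m))))
  where P? = λ p → prime? p ×-dec (p ∣? m)

betaFrom-maximal : ∀ b k {m} → 0 < m → m ≤ k → rad m ∣ b → m ≤ betaFrom b k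
betaFrom-maximal b zero    0<m m≤0 _ = contradiction m≤0 (<⇒≱ 0<m)
betaFrom-maximal b (suc k) 0<m m≤k r with rad (suc k) ∣? b
... | yes _ = m≤k
... | no ¬r with m≤n⇒m<n∨m≡n m≤k
...   | inj₁ m<k  = betaFrom-maximal b k 0<m (≤-pred m<k) r
...   | inj₂ refl = contradiction r ¬r

∣^⇒≤beta : ∀ b s {m} → 0 < m → m < b → m ∣ b ^ s → m ≤ beta b
∣^⇒≤beta b s 0<m m<b m∣b^s =
  betaFrom-maximal b (b ∸ 1) 0<m (∸-monoˡ-≤ 1 m<b) (∣^⇒rad∣ _ b s m∣b^s)

[m+n*k]%n≡m : ∀ {m n} k .{{_ : NonZero n}} → m < n → (m + n * k) % n ≡ m
[m+n*k]%n≡m {m} k m<n = trans (%-remove-+ʳ m (m∣m*n k)) (m<n⇒m%n≡m m<n)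

[m+n*k]/n≡k : ∀ {m n} k .{{_ : NonZero n}} → m < n → (m + n * k) / n ≡ k
[m+n*k]/n≡k {m} {n} k m<n = begin
  (m + n * k) / n   ≡⟨ +-distrib-/-∣ʳ m (m∣m*n k) ⟩
  m / n + n * k / n ≡⟨ cong₂ _+_ (m<n⇒m/n≡0 m<n) (cong (_/ n) (*-comm n k)) ⟩
  k * n / n         ≡⟨ m*n/n≡m k n ⟩
  k                 ∎
  where open ≡-Reasoning

digit : (b : ℕ) .{{_ : NonZero b}} → ℕ → ℕ → ℕ
digit b s n = n / b ^ s % b
  where instance _ = m^n≢0 b s

InKempner⇒digit∈ : ∀ {b S n} .{{_ : NonZero b}} → InKempner b S n →
  ∀ s (x : Fin b) → 0 < toℕ x → digit b s n ≡ toℕ x → x ∈ S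
InKempner⇒digit∈ {b} kempner-zero s x 0<x digit≡x =
  contradiction (trans (sym digit≡x) (trans (cong (_% b) (0/n≡0 (b ^ s))) (m<n⇒m%n≡m (>-nonZero⁻¹ b))))
                (>⇒≢ 0<x)
  where instance _ = m^n≢0 b s
InKempner⇒digit∈ {b} {S} (kempner-digit t m t∈S _) zero x _ digit≡x =
  subst (_∈ S) (toℕ-injective t≡x) t∈S
  where
    t≡x : toℕ t ≡ toℕ x
    t≡x = begin
      toℕ t                       ≡⟨ [m+n*k]%n≡m m (toℕ<n t) ⟨
      (toℕ t + b * m) % b         ≡⟨ cong (_% b) (n/1≡n _) ⟨
      (toℕ t + b * m) / 1 % b     ≡⟨ digit≡x ⟩
      toℕ x                       ∎
      where open ≡-Reasoning
InKempner⇒digit∈ {b} (kempner-digit t m _ m∈K) (suc s) x 0<x digit≡x =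
  InKempner⇒digit∈ m∈K s x 0<x (trans (cong (_% b) m/b^s≡n/b^[1+s]) digit≡x)
  where
    instance
      _ = m^n≢0 b s
      _ = m^n≢0 b (suc s)
    n = toℕ t + b * m
    m/b^s≡n/b^[1+s] : m / b ^ s ≡ n / b ^ suc s
    m/b^s≡n/b^[1+s] = begin
      m / b ^ s         ≡⟨ cong (_/ b ^ s) ([m+n*k]/n≡k m (toℕ<n t)) ⟨
      n / b / b ^ s     ≡⟨ m/n/o≡m/[n*o] n b (b ^ s) ⟩
      n / b ^ suc s     ∎
      where open ≡-Reasoning

injective-meets-interval : ∀ {L Q z c} (f : ℕ → ℕ) → (∀ {i} → i ≤ L → f i < Q) →
  (∀ {i j} → i < j → j ≤ L → f i ≢ f j) → z + c ≤ Q → Q ≤ L + c →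
  ∃[ i ] i ≤ L × z ≤ f i × f i < z + c
injective-meets-interval {L} {Q} {z} {c} f f<Q f-injective z+c≤Q Q≤L+c =
  collision⇒hit (pigeonhole (s≤s Q≤L+c) h)
  where
    -- Arguments past L are sent injectively onto [z, z + c), so a collision of the extension is a hit.
    extend : ∀ {u} → Dec (u ≤ L) → ℕ
    extend {u} (yes _) = f u
    extend {u} (no _)  = z + (u ∸ suc L)

    overshoot<c : ∀ {u} → u < suc L + c → ¬ u ≤ L → u ∸ suc L < c
    overshoot<c {u} u<sL+c u≰L = subst (u ∸ suc L <_) (m+n∸m≡n (suc L) c) (∸-monoˡ-< u<sL+c (≰⇒> u≰L))

    extend<Q : ∀ {u} → u < suc L + c → (u≤?L : Dec (u ≤ L)) → extend u≤?L < Q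
    extend<Q _      (yes u≤L) = f<Q u≤L
    extend<Q u<sL+c (no u≰L)  = ≤-trans (+-monoʳ-< z (overshoot<c u<sL+c u≰L)) z+c≤Q

    h : Fin (suc L + c) → Fin Q
    h u = fromℕ< (extend<Q (toℕ<n u) (toℕ u ≤? L))

    conclude : ∀ {u v} (u≤?L : Dec (u ≤ L)) (v≤?L : Dec (v ≤ L)) → u < v → v < suc L + c →
      extend u≤?L ≡ extend v≤?L → ∃[ i ] i ≤ L × z ≤ f i × f i < z + c
    conclude (yes u≤L) (yes v≤L) u<v _ fu≡fv = contradiction fu≡fv (f-injective u<v v≤L)
    conclude {u} (yes u≤L) (no v≰L) _ v<sL+c fu≡ =
      u , u≤L , subst (z ≤_) (sym fu≡) (m≤m+n z _) ,
      subst (_< z + c) (sym fu≡) (+-monoʳ-< z (overshoot<c v<sL+c v≰L))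
    conclude (no u≰L) (yes v≤L) u<v _ _ = contradiction (≤-trans (<⇒≤ u<v) v≤L) u≰L
    conclude (no u≰L) (no v≰L) u<v _ z+u≡z+v =
      contradiction (∸-cancelʳ-≡ (≰⇒> u≰L) (≰⇒> v≰L) (+-cancelˡ-≡ z _ _ z+u≡z+v)) (<⇒≢ u<v)

    collision⇒hit : ∃[ u ] ∃[ v ] u Fin.< v × h u ≡ h v → ∃[ i ] i ≤ L × z ≤ f i × f i < z + c
    collision⇒hit (u , v , u<v , hu≡hv) = conclude (toℕ u ≤? L) (toℕ v ≤? L) u<v (toℕ<n v)
      (trans (sym (toℕ-fromℕ< (extend<Q (toℕ<n u) (toℕ u ≤? L))))
             (trans (cong toℕ hu≡hv) (toℕ-fromℕ< (extend<Q (toℕ<n v) (toℕ v ≤? L)))))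

[m+n]%o≡m%o⇒o∣n : ∀ m n o .{{_ : NonZero o}} → (m + n) % o ≡ m % o → o ∣ n
[m+n]%o≡m%o⇒o∣n m n o residues≡ =
  ∣m+n∣m⇒∣n (subst (o ∣_) (sym quotients) (n∣m*n ((m + n) / o))) (n∣m*n (m / o))
  where
    open ≡-Reasoning
    quotients : m / o * o + n ≡ (m + n) / o * o
    quotients = +-cancelˡ-≡ (m % o) _ _ (begin
      m % o + (m / o * o + n)       ≡⟨ +-assoc (m % o) _ n ⟨
      m % o + m / o * o + n         ≡⟨ cong (_+ n) (m≡m%n+[m/n]*n m o) ⟨
      m + n                         ≡⟨ m≡m%n+[m/n]*n (m + n) o ⟩
      (m + n) % o + (m + n) / o * o ≡⟨ cong (_+ (m + n) / o * o) residues≡ ⟩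
      m % o + (m + n) / o * o       ∎)

coprime⇒ap-residues-distinct : ∀ {Q k} .{{_ : NonZero Q}} → Coprime Q k →
  ∀ w {i j} → i < j → j < Q → (w + i * k) % Q ≢ (w + j * k) % Q
coprime⇒ap-residues-distinct {Q} {k} Q⊥k w {i} {j} i<j j<Q residues≡ =
  <⇒≱ (≤-<-trans (m∸n≤m j i) j<Q) (∣⇒≤ {{>-nonZero (m<n⇒0<n∸m i<j)}} Q∣j∸i)
  where
    open ≡-Reasoning
    step : w + j * k ≡ (w + i * k) + k * (j ∸ i)
    step = begin
      w + j * k                   ≡⟨ cong (λ t → w + t * k) (m+[n∸m]≡n (<⇒≤ i<j)) ⟨
      w + (i + (j ∸ i)) * k       ≡⟨ cong (w +_) (*-distribʳ-+ k i (j ∸ i)) ⟩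
      w + (i * k + (j ∸ i) * k)   ≡⟨ +-assoc w (i * k) _ ⟨
      w + i * k + (j ∸ i) * k     ≡⟨ cong (w + i * k +_) (*-comm (j ∸ i) k) ⟩
      w + i * k + k * (j ∸ i)     ∎
    Q∣j∸i : Q ∣ j ∸ i
    Q∣j∸i = coprime-divisor Q⊥k
      ([m+n]%o≡m%o⇒o∣n (w + i * k) _ Q (trans (cong (_% Q) (sym step)) (sym residues≡)))

residue-class-meets-interval : ∀ {G r} → r < G → ∀ N → ∃[ z ] N ≤ z * G + r × z * G + r < N + G
residue-class-meets-interval r<G zero = 0 , z≤n , r<G
residue-class-meets-interval {G} {r} r<G (suc N)
  with z , N≤zG+r , zG+r<N+G ← residue-class-meets-interval r<G N
  with m≤n⇒m<n∨m≡n N≤zG+r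
... | inj₁ N<zG+r = z , N<zG+r , m<n⇒m<1+n zG+r<N+G
... | inj₂ N≡zG+r = suc z , N<N+G , subst (_< suc N + G) (sym next≡) (n<1+n (N + G))
  where
    open ≡-Reasoning
    next≡ : suc z * G + r ≡ N + G
    next≡ = begin
      G + z * G + r   ≡⟨ +-assoc G (z * G) r ⟩
      G + (z * G + r) ≡⟨ cong (G +_) N≡zG+r ⟨
      G + N           ≡⟨ +-comm G N ⟩
      N + G           ∎
    N<N+G : N < suc z * G + r
    N<N+G = subst (N <_) (sym next≡) (m<m+n N (≤-<-trans z≤n r<G))

[m*n+o]%[p*n]≡m%p*n+o : ∀ m {n o} p .{{_ : NonZero p}} .{{_ : NonZero (p * n)}} → o < n →
  (m * n + o) % (p * n) ≡ m % p * n + o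
[m*n+o]%[p*n]≡m%p*n+o m {n} {o} p o<n = begin
  (m * n + o) % (p * n)     ≡⟨ [m*n+o]%[p*n]≡[m*n]%[p*n]+o m p o<n ⟩
  m * n % (p * n) + o       ≡⟨ cong (_+ o) (m%n*o≡m*o%[n*o] m p n) ⟨
  m % p * n + o             ∎
  where open ≡-Reasoning

v<w∧w*n+r<x+n⇒v*n+r<x : ∀ {n r x v w} → w * n + r < x + n → v < w → v * n + r < x
v<w∧w*n+r<x+n⇒v*n+r<x {n} {r} {x} {v} {w} wn+r<x+n v<w = +-cancelʳ-< n (v * n + r) x (begin-strict
  v * n + r + n   ≡⟨ solve 3 (λ v n r → v :* n :+ r :+ n := (con 1 :+ v) :* n :+ r) refl v n r ⟩
  suc v * n + r   ≤⟨ +-monoˡ-≤ r (*-monoˡ-≤ n v<w) ⟩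
  w * n + r       <⟨ wn+r<x+n ⟩
  x + n           ∎)
  where open ≤-Reasoning

module _ {M d G : ℕ} .{{_ : NonZero M}} .{{_ : NonZero G}} (G-gcd : GCD d M G) where
  private
    Q k : ℕ
    Q = M / G
    k = d / G

    M≡Q*G : M ≡ Q * G
    M≡Q*G = sym (m/n*n≡m (GCD.gcd∣n G-gcd))

    instance
      Q-nonZero : NonZero Q
      Q-nonZero = >-nonZero (m≥n⇒m/n>0 (∣⇒≤ (GCD.gcd∣n G-gcd)))
      QG-nonZero : NonZero (Q * G)
      QG-nonZero = m*n≢0 Q G

    Q⊥k : Coprime Q k
    Q⊥k = coprime-sym (GCD≡1⇒coprime (subst (GCD k Q) (n/n≡1 G)
      (GCD-/ (GCD.gcd∣m G-gcd) (GCD.gcd∣n G-gcd) ∣-refl G-gcd)))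

    ap-residue : ∀ a i → (a + i * d) % M ≡ (a / G + i * k) % Q * G + a % G
    ap-residue a i = begin
      (a + i * d) % M                         ≡⟨ %-congˡ (cong₂ (λ x y → x + i * y) (m≡m%n+[m/n]*n a G) d≡k*G) ⟩
      (a % G + a / G * G + i * (k * G)) % M   ≡⟨ %-congˡ (regroup (a % G) (a / G) G i k) ⟩
      ((a / G + i * k) * G + a % G) % M       ≡⟨ %-congʳ M≡Q*G ⟩
      ((a / G + i * k) * G + a % G) % (Q * G) ≡⟨ [m*n+o]%[p*n]≡m%p*n+o (a / G + i * k) Q (m%n<n a G) ⟩
      (a / G + i * k) % Q * G + a % G         ∎
      where
        open ≡-Reasoning
        d≡k*G : d ≡ k * G
        d≡k*G = sym (m/n*n≡m (GCD.gcd∣m G-gcd))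
        regroup : ∀ r w G i k → r + w * G + i * (k * G) ≡ (w + i * k) * G + r
        regroup = solve 5 (λ r w G i k → r :+ w :* G :+ i :* (k :* G) := (w :+ i :* k) :* G :+ r) refl

  ap-meets-interval : ∀ a N {W} → N + W ≤ M → G ≤ W →
    ∃[ i ] i ≤ M / G ∸ W / G × N ≤ (a + i * d) % M × (a + i * d) % M < N + W
  ap-meets-interval a N {W} N+W≤M G≤W
    with z , N≤zG+r , zG+r<N+G ← residue-class-meets-interval (m%n<n a G) N
    = hit (injective-meets-interval f (λ _ → m%n<n _ Q) f-distinct z+c≤Q (≤-reflexive (sym (m∸n+n≡m c≤Q))))
    where
      c r : ℕ
      c = W / G
      r = a % G
      f : ℕ → ℕ
      f i = (a / G + i * k) % Q

      [z+c]*G+r<N+W+G : (z + c) * G + r < (N + W) + G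
      [z+c]*G+r<N+W+G = begin-strict
        (z + c) * G + r   ≡⟨ regroup z c G r ⟩
        z * G + r + c * G <⟨ +-monoˡ-< (c * G) zG+r<N+G ⟩
        N + G + c * G     ≤⟨ +-monoʳ-≤ (N + G) (m/n*n≤m W G) ⟩
        N + G + W         ≡⟨ +-assoc N G W ⟩
        N + (G + W)       ≡⟨ cong (N +_) (+-comm G W) ⟩
        N + (W + G)       ≡⟨ +-assoc N W G ⟨
        N + W + G         ∎
        where
          open ≤-Reasoning
          regroup : ∀ z c G r → (z + c) * G + r ≡ z * G + r + c * G
          regroup = solve 4 (λ z c G r → (z :+ c) :* G :+ r := (z :* G :+ r) :+ c :* G) refl

      z+c≤Q : z + c ≤ Q
      z+c≤Q = ≤-pred (*-cancelʳ-< G (z + c) (suc Q) (begin-strict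
        (z + c) * G     ≤⟨ m≤m+n _ r ⟩
        (z + c) * G + r <⟨ [z+c]*G+r<N+W+G ⟩
        N + W + G       ≤⟨ +-monoˡ-≤ G N+W≤M ⟩
        M + G           ≡⟨ cong (_+ G) M≡Q*G ⟩
        Q * G + G       ≡⟨ +-comm (Q * G) G ⟩
        suc Q * G       ∎))
        where open ≤-Reasoning

      c≤Q : c ≤ Q
      c≤Q = ≤-trans (m≤n+m c z) z+c≤Q

      f-distinct : ∀ {i j} → i < j → j ≤ Q ∸ c → f i ≢ f j
      f-distinct i<j j≤L = coprime⇒ap-residues-distinct Q⊥k (a / G) i<j
        (≤-<-trans j≤L (∸-monoʳ-< (m≥n⇒m/n>0 G≤W) c≤Q))

      hit : ∃[ i ] i ≤ Q ∸ c × z ≤ f i × f i < z + c →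
        ∃[ i ] i ≤ Q ∸ c × N ≤ (a + i * d) % M × (a + i * d) % M < N + W
      hit (i , i≤L , z≤fi , fi<z+c) = i , i≤L ,
        subst (N ≤_) (sym (ap-residue a i)) (≤-trans N≤zG+r (+-monoˡ-≤ r (*-monoˡ-≤ G z≤fi))) ,
        subst (_< N + W) (sym (ap-residue a i)) (v<w∧w*n+r<x+n⇒v*n+r<x {G} {r} {N + W} [z+c]*G+r<N+W+G fi<z+c)

n<m^n : ∀ {m} → 1 < m → ∀ n → n < m ^ n
n<m^n 1<m zero    = s≤s z≤n
n<m^n {m} 1<m (suc n) = begin-strict
  suc n             ≡⟨ +-comm 1 n ⟩
  n + 1             <⟨ +-monoˡ-< 1 (n<m^n 1<m n) ⟩
  m ^ n + 1         ≤⟨ +-monoʳ-≤ (m ^ n) (≤-trans (m^n>0 m n) (m≤m+n _ 0)) ⟩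
  2 * m ^ n         ≤⟨ *-monoˡ-≤ (m ^ n) 1<m ⟩
  m * m ^ n         ∎
  where
    open ≤-Reasoning
    instance _ = >-nonZero (<-trans (s≤s z≤n) 1<m)

critical-exponent : ∀ {b d} → 1 < b → 0 < d →
  ∃[ s ] gcd d (b ^ suc s) ≤ b ^ s × b ^ s < gcd d (b ^ s) * b
critical-exponent {b} {d} 1<b 0<d = search d 0 start (<⇒≤ (n<m^n 1<b d))
  where
    instance _ = >-nonZero (<-trans (s≤s z≤n) 1<b)

    start : b ^ 0 < gcd d 1 * b
    start = subst (λ g → 1 < g * b) (sym (gcd-zeroʳ d)) (subst (1 <_) (sym (*-identityˡ b)) 1<b)

    search : ∀ fuel s → b ^ s < gcd d (b ^ s) * b → d ≤ b ^ (s + fuel) →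
      ∃[ s ] gcd d (b ^ suc s) ≤ b ^ s × b ^ s < gcd d (b ^ s) * b
    search zero s below d≤b^s =
      s , ≤-trans (∣⇒≤ {{>-nonZero 0<d}} (gcd[m,n]∣m d _)) (subst (λ t → d ≤ b ^ t) (+-identityʳ s) d≤b^s)
        , below
    search (suc fuel) s below d≤b^[s+1+fuel] with gcd d (b ^ suc s) ≤? b ^ s
    ... | yes small = s , small , below
    ... | no  large = search fuel (suc s)
          (subst (b * b ^ s <_) (*-comm b _) (*-monoʳ-< b (≰⇒> large)))
          (subst (λ t → d ≤ b ^ t) (+-suc s fuel) d≤b^[s+1+fuel])

m≤n*o∧m<n*[1+p]⇒m∸p≤[n∸1]*o : ∀ {m n o p} → m ≤ n * o → m < n * suc p → m ∸ p ≤ (n ∸ 1) * o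
m≤n*o∧m<n*[1+p]⇒m∸p≤[n∸1]*o {m} {suc n} {o} {p} m≤[1+n]o m<[1+n][1+p] with o ≤? p
... | yes o≤p = m≤n+o⇒m∸n≤o m p (≤-trans m≤[1+n]o (+-monoˡ-≤ (n * o) o≤p))
... | no  o≰p = ≤-trans (m≤n+o⇒m∸n≤o m p (≤-pred m<[1+n][1+p])) (*-monoʳ-≤ n (≰⇒> o≰p))

/-window : ∀ {m n x} .{{_ : NonZero n}} → x * n ≤ m → m < suc x * n → m / n ≡ x
/-window {m} {n} {x} x*n≤m m<[1+x]*n = ≤-antisym (≤-pred (m<n*o⇒m/o<n m<[1+x]*n))
  (subst (_≤ m / n) (m*n/n≡m x n) (/-monoˡ-≤ n x*n≤m))

module _ {b d : ℕ} .{{_ : NonZero b}} (s : ℕ)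
         (gcd-small : gcd d (b ^ suc s) ≤ b ^ s) (gcd-large : b ^ s < gcd d (b ^ s) * b) where
  private
    B M G G⁻ : ℕ
    B  = b ^ s
    M  = b ^ suc s
    G  = gcd d M
    G⁻ = gcd d B

    instance
      B-nonZero : NonZero B
      B-nonZero = m^n≢0 b s
      M-nonZero : NonZero M
      M-nonZero = m^n≢0 b (suc s)
      G-nonZero : NonZero G
      G-nonZero = ≢-nonZero (gcd[m,n]≢0 d M (inj₂ (≢-nonZero⁻¹ M)))
      G⁻-nonZero : NonZero G⁻
      G⁻-nonZero = ≢-nonZero (gcd[m,n]≢0 d B (inj₂ (≢-nonZero⁻¹ B)))

    B/G⁻≤beta : B / G⁻ ≤ beta b
    B/G⁻≤beta = ∣^⇒≤beta b s (m≥n⇒m/n>0 (gcd[m,n]≤n d B))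
      (m<n*o⇒m/o<n (subst (B <_) (*-comm G⁻ b) gcd-large)) (m/n∣m (gcd[m,n]∣n d B))

    M/G≤b*[B/G⁻] : M / G ≤ b * (B / G⁻)
    M/G≤b*[B/G⁻] = *-cancelʳ-≤ (M / G) (b * (B / G⁻)) G (begin
      M / G * G           ≡⟨ m/n*n≡m (gcd[m,n]∣n d M) ⟩
      b * B               ≡⟨ cong (b *_) (m/n*n≡m (gcd[m,n]∣n d B)) ⟨
      b * (B / G⁻ * G⁻)   ≤⟨ *-monoʳ-≤ b (*-monoʳ-≤ (B / G⁻) G⁻≤G) ⟩
      b * (B / G⁻ * G)    ≡⟨ *-assoc b (B / G⁻) G ⟨
      b * (B / G⁻) * G    ∎)
      where
        open ≤-Reasoning
        G⁻≤G : G⁻ ≤ G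
        G⁻≤G = ∣⇒≤ (gcd-greatest (gcd[m,n]∣m d B) (∣-trans (gcd[m,n]∣n d B) (n∣m*n b)))

    M/G<b*[1+B/G] : M / G < b * suc (B / G)
    M/G<b*[1+B/G] = *-cancelʳ-< G (M / G) (b * suc (B / G)) (begin-strict
      M / G * G               ≡⟨ m/n*n≡m (gcd[m,n]∣n d M) ⟩
      b * B                   <⟨ *-monoʳ-< b B<[1+B/G]*G ⟩
      b * (suc (B / G) * G)   ≡⟨ *-assoc b _ G ⟨
      b * suc (B / G) * G     ∎)
      where
        open ≤-Reasoning
        B<[1+B/G]*G : B < suc (B / G) * G
        B<[1+B/G]*G = subst (_< suc (B / G) * G) (sym (m≡m%n+[m/n]*n B G))
          (+-monoˡ-< (B / G * G) (m%n<n B G))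

    M/G∸B/G≤[b∸1]*beta : M / G ∸ B / G ≤ (b ∸ 1) * beta b
    M/G∸B/G≤[b∸1]*beta = ≤-trans
      (m≤n*o∧m<n*[1+p]⇒m∸p≤[n∸1]*o {n = b} M/G≤b*[B/G⁻] M/G<b*[1+B/G])
      (*-monoʳ-≤ (b ∸ 1) B/G⁻≤beta)

  digit-appears-early : ∀ {x} → x < b → ∀ a → ∃[ i ] i ≤ (b ∸ 1) * beta b × digit b s (a + i * d) ≡ x
  digit-appears-early {x} x<b a =
    let i , i≤ , lower , upper = ap-meets-interval (gcd-GCD d M) a (x * B) {B} x*B+B≤M gcd-small
    in i , ≤-trans i≤ M/G∸B/G≤[b∸1]*beta ,
       trans (sym (m%[n*o]/o≡m/o%n (a + i * d) b B))
             (/-window lower (subst ((a + i * d) % M <_) (+-comm (x * B) B) upper))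
    where
      x*B+B≤M : x * B + B ≤ M
      x*B+B≤M = subst (_≤ M) (+-comm B (x * B)) (*-monoˡ-≤ B x<b)

Proper⇒missing-nonzero-digit : ∀ {b S} → Proper b S → ∃[ x ] x ∉ S × 0 < toℕ x
Proper⇒missing-nonzero-digit {S = S} ((z , z≡0 , z∈S) , (x , x∉S)) = x , x∉S , n≢0⇒n>0 x≢0
  where
    x≢0 : toℕ x ≢ 0
    x≢0 x≡0 = x∉S (subst (_∈ S) (toℕ-injective (trans z≡0 (sym x≡0))) z∈S)

proposition2p4 : (b : ℕ) → 2 ≤ b → (S : Subset b) → Proper b S →
    (a d k : ℕ) → 0 < d → APIn b S a d k → k ≤ (b ∸ 1) * beta b
proposition2p4 b 2≤b S proper a d k 0<d ap =
  from-digit-and-exponent (Proper⇒missing-nonzero-digit proper) (critical-exponent 2≤b 0<d)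
  where
    instance
      b-nonZero : NonZero b
      b-nonZero = >-nonZero (<-trans (s≤s z≤n) 2≤b)

    from-digit-and-exponent : ∃[ x ] x ∉ S × 0 < toℕ x →
      ∃[ s ] gcd d (b ^ suc s) ≤ b ^ s × b ^ s < gcd d (b ^ s) * b → k ≤ (b ∸ 1) * beta b
    from-digit-and-exponent (x , x∉S , 0<x) (s , gcd-small , gcd-large) =
      from-early-term (digit-appears-early s gcd-small gcd-large (toℕ<n x) a)
      where
        from-early-term : ∃[ i ] i ≤ (b ∸ 1) * beta b × digit b s (a + i * d) ≡ toℕ x →
          k ≤ (b ∸ 1) * beta b
        from-early-term (i , i≤bound , digit≡x) =
          ≤-trans (≮⇒≥ (λ i<k → x∉S (InKempner⇒digit∈ (ap i i<k) s x 0<x digit≡x))) i≤bound
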